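{- Let $G=(A\cup P,\mathcal{E})$ be an instance of the rank-maximal matching problem and $a_1\in A$. Assume that there is a rank-maximal matching of $G$ in which $a_1$ is not matched to a rank one post. Then a post is an $f$-post (with respect to $a_1$) if and only if it belongs to $O(G_1)\cup U(G_1)$.
   Context: An instance is a bipartite graph $G=(A\cup P,\mathcal{E})$ ($A$ = applicants, $P$ = posts) in which each edge $(a,p)$ has a positive integer rank describing $a$'s preference list (ties allowed; smaller rank = more preferred). Let $r$ be the largest rank. A matching is a set of edges no two sharing an endpoint. The signature of a matching $M$ is $(x_1,\dots,x_r)$ with $x_i$ the number of applicants matched in $M$ by a rank $i$ edge; a matching is rank-maximal if its signature is lexicographically largest among all matchings. $G_1$ denotes the subgraph of $G$ consisting of the rank one edges. For a bipartite graph $K$ with a maximum matching $M$, a vertex is even (resp. odd) if it is reachable from some vertex unmatched in $M$ by an $M$-alternating path of even (resp. odd) length, and unreachable otherwise; the sets $E(K),O(K),U(K)$ of even, odd and unreachable vertices do not depend on the choice of $M$. A post is an $f$-post (with respect to $a_1$) if it belongs to $O(K)\cup U(K)$, where $K$ is the graph obtained from $G_1$ by deleting the vertex $a_1$; all other posts are non-$f$-posts. -}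

module Defs where

open import Data.Nat using (ℕ; zero; suc; _+_; _<_; _≤_; _%_; _≡ᵇ_)
open import Data.Fin using (Fin; toℕ; fromℕ; inject₁)
open import Data.List using (List; map; allFin)
open import Data.Nat.ListAction using (sum)
open import Data.Maybe using (Maybe; just; nothing)
open import Data.Bool using (Bool; true; false; if_then_else_)
open import Data.Sum using (_⊎_; inj₁; inj₂)
open import Data.Product using (Σ; ∃; _×_; _,_)
open import Relation.Binary.PropositionalEquality using (_≡_; _≢_)
open import Relation.Nullary using (¬_)
open import Function.Definitions using (Injective)
open import Data.Empty using (⊥)
import Data.Fin as Fin

-- Instances.  Applicants are Fin nA, posts are Fin nP.
-- rank a p = 0 means "no edge (a,p)"; rank a p = suc k means that
-- (a,p) is an edge of rank suc k (ranks are positive integers).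

Rank : ℕ → ℕ → Set
Rank nA nP = Fin nA → Fin nP → ℕ

BGraph : ℕ → ℕ → Set₁
BGraph nA nP = Fin nA → Fin nP → Set

graphOf : ∀ {nA nP} → Rank nA nP → BGraph nA nP
graphOf rank a p = rank a p ≢ 0

G₁ : ∀ {nA nP} → Rank nA nP → BGraph nA nP
G₁ rank a p = rank a p ≡ 1

G₁-minus : ∀ {nA nP} → Rank nA nP → Fin nA → BGraph nA nP
G₁-minus rank a₁ a p = (rank a p ≡ 1) × (a ≢ a₁)

Assignment : ℕ → ℕ → Set
Assignment nA nP = Fin nA → Maybe (Fin nP)

IsMatching : ∀ {nA nP} → BGraph nA nP → Assignment nA nP → Set
IsMatching K m =
  (∀ a p → m a ≡ just p → K a p) ×
  (∀ a a' p → m a ≡ just p → m a' ≡ just p → a ≡ a')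

countB : ∀ {n} → (Fin n → Bool) → ℕ
countB {n} t = sum (map (λ a → if t a then 1 else 0) (allFin n))

size : ∀ {nA nP} → Assignment nA nP → ℕ
size m = countB (λ a → matched (m a))
  where
  matched : ∀ {X : Set} → Maybe X → Bool
  matched (just _) = true
  matched nothing  = false

IsMaximumMatching : ∀ {nA nP} → BGraph nA nP → Assignment nA nP → Set
IsMaximumMatching K m =
  IsMatching K m × (∀ m' → IsMatching K m' → size m' ≤ size m)

signature : ∀ {nA nP} → Rank nA nP → Assignment nA nP → ℕ → ℕ
signature rank m i = countB test
  where
  test : _ → Bool
  test a with m a
  ... | just p  = rank a p ≡ᵇ i
  ... | nothing = false

LexGreater : (ℕ → ℕ) → (ℕ → ℕ) → Set
LexGreater x y = ∃ λ i → (∀ j → j < i → x j ≡ y j) × (y i < x i)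

IsRankMaximal : ∀ {nA nP} → Rank nA nP → Assignment nA nP → Set
IsRankMaximal rank m =
  IsMatching (graphOf rank) m ×
  (∀ m' → IsMatching (graphOf rank) m' →
     ¬ LexGreater (signature rank m') (signature rank m))

Vertex : ℕ → ℕ → Set
Vertex nA nP = Fin nA ⊎ Fin nP

Adj : ∀ {nA nP} → BGraph nA nP → Vertex nA nP → Vertex nA nP → Set
Adj K (inj₁ a) (inj₂ p) = K a p
Adj K (inj₂ p) (inj₁ a) = K a p
Adj K _ _ = ⊥

InM : ∀ {nA nP} → Assignment nA nP → Vertex nA nP → Vertex nA nP → Set
InM m (inj₁ a) (inj₂ p) = m a ≡ just p
InM m (inj₂ p) (inj₁ a) = m a ≡ just p
InM m _ _ = ⊥

Unmatched : ∀ {nA nP} → Assignment nA nP → Vertex nA nP → Set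
Unmatched m (inj₁ a) = m a ≡ nothing
Unmatched m (inj₂ p) = ∀ a → m a ≢ just p

record AltPath {nA nP} (K : BGraph nA nP) (m : Assignment nA nP) (k : ℕ) : Set where
  field
    π         : Fin (suc k) → Vertex nA nP
    simple    : Injective _≡_ _≡_ π
    start     : Unmatched m (π Fin.zero)
    adjacent  : ∀ (i : Fin k) → Adj K (π (inject₁ i)) (π (Fin.suc i))
    alternate : ∀ (i : Fin k) →
                  (InM m (π (inject₁ i)) (π (Fin.suc i)) → toℕ i % 2 ≡ 1) ×
                  (toℕ i % 2 ≡ 1 → InM m (π (inject₁ i)) (π (Fin.suc i)))
  endpoint : Vertex nA nP
  endpoint = π (fromℕ k)

IsEven : ∀ {nA nP} → BGraph nA nP → Assignment nA nP → Vertex nA nP → Set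
IsEven K m v = ∃ λ k → Σ (AltPath K m k) λ P → (k % 2 ≡ 0) × (AltPath.endpoint P ≡ v)

IsOdd : ∀ {nA nP} → BGraph nA nP → Assignment nA nP → Vertex nA nP → Set
IsOdd K m v = ∃ λ k → Σ (AltPath K m k) λ P → (k % 2 ≡ 1) × (AltPath.endpoint P ≡ v)

IsUnreachable : ∀ {nA nP} → BGraph nA nP → Assignment nA nP → Vertex nA nP → Set
IsUnreachable K m v = ¬ IsEven K m v × ¬ IsOdd K m v

-- v ∈ O(K) ∪ U(K).  These sets do not depend on the maximum matching
-- chosen; we quantify over all maximum matchings of K.
InOU : ∀ {nA nP} → BGraph nA nP → Vertex nA nP → Set
InOU K v = ∀ m → IsMaximumMatching K m → IsOdd K m v ⊎ IsUnreachable K m v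

IsFPost : ∀ {nA nP} → Rank nA nP → Fin nA → Fin nP → Set
IsFPost rank a₁ p = InOU (G₁-minus rank a₁) (inj₂ p)

module Submission where

-- Write K₁ = G₁ and K₀ = G₁ - a₁.  For a bipartite graph K with
-- decidable edges, a post lies in O(K) ∪ U(K) iff it is covered by every
-- maximum matching of K: a free post is even (trivial path) and cannot be odd
-- (an odd path to it would augment), while an even post is freed by flipping
-- the even path to it.  So both sides of Lemma 4 become "p is covered by every
-- maximum matching", of K₀ resp. K₁.  The rank-one part Y of the rank-maximal
-- matching M is a maximum matching of K₁ leaving a₁ free, so K₀ and K₁ have the
-- same maximum size and the maximum matchings of K₀ are those of K₁ leaving a₁
-- free.  Finally an exchange argument along the alternating chain from a₁
-- turns any maximum matching of K₁ leaving p free into one leaving a₁ and p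
-- free.

open import Defs
open import Data.Nat using (ℕ; zero; suc; _+_; _≤_; _<_; _%_; _≡ᵇ_; z≤n; s≤s)
open import Data.Nat.Properties
  using ( ≤-refl; ≤-trans; ≤-reflexive; <⇒≤; <⇒≢; <⇒≱; ≰⇒>; m≤n⇒m<n∨m≡n; m≤n+m
        ; +-comm; +-assoc; +-suc; +-identityʳ; +-cancelʳ-≡; +-mono-≤; +-mono-≤-<; +-monoˡ-≤
        ; suc-injective; ≡⇒≡ᵇ; ≡ᵇ⇒≡; _≟_; _<?_; _≤?_; anyUpTo?; module ≤-Reasoning )
open import Data.Fin using (Fin; zero; suc; toℕ; fromℕ; fromℕ<; inject₁; join; splitAt)
import Data.Fin as Fin
import Data.Fin.Properties as FinP
open import Data.Bool using (Bool; true; false; if_then_else_)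
open import Data.Bool.Properties using (T-≡)
open import Data.List using (tabulate)
open import Data.List.Properties using (map-tabulate)
open import Data.Nat.ListAction using (sum)
open import Data.Maybe using (Maybe; just; nothing; is-just)
import Data.Maybe.Properties as MaybeP
open import Data.Sum using (_⊎_; inj₁; inj₂)
import Data.Sum.Properties as SumP
open import Data.Product using (Σ; ∃; _×_; _,_; proj₁; proj₂)
open import Data.Empty using (⊥; ⊥-elim)
open import Relation.Binary.PropositionalEquality
  using (_≡_; _≢_; refl; sym; trans; cong; cong₂; subst; subst₂; module ≡-Reasoning)
open import Relation.Nullary using (¬_; Dec; yes; no; does)
open import Relation.Nullary.Decidable using (dec-true; dec-false; _×-dec_; _⊎-dec_; _→-dec_; ¬?)
open import Function using (_∘_; id)
open import Function.Bundles using (_⇔_; mk⇔; Equivalence)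

-- Counting.  `count n t` is the number of i : Fin n with t i ≡ true, the
-- structurally recursive form of `countB` (which defines `size` and
-- `signature`); all cardinality arguments are carried out on `count`.

indicator : Bool → ℕ
indicator b = if b then 1 else 0

count : ∀ n → (Fin n → Bool) → ℕ
count zero    t = 0
count (suc n) t = indicator (t zero) + count n (t ∘ suc)

countB≡count : ∀ {n} (t : Fin n → Bool) → countB t ≡ count n t
countB≡count {n} t = trans (cong sum (map-tabulate id (indicator ∘ t))) (sum-tabulate n t)
  where
  sum-tabulate : ∀ n (t : Fin n → Bool) → sum (tabulate (indicator ∘ t)) ≡ count n t
  sum-tabulate zero    t = refl
  sum-tabulate (suc n) t = cong (indicator (t zero) +_) (sum-tabulate n (t ∘ suc))

count-cong : ∀ n {t t' : Fin n → Bool} → (∀ i → t i ≡ t' i) → count n t ≡ count n t'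
count-cong zero    eq = refl
count-cong (suc n) eq = cong₂ _+_ (cong indicator (eq zero)) (count-cong n (eq ∘ suc))

countB-as-count : ∀ {n} {t t' : Fin n → Bool} → (∀ i → t i ≡ t' i) → countB t ≡ count n t'
countB-as-count {n} {t} eq = trans (countB≡count t) (count-cong n eq)

indicator-mono : ∀ {b b'} → (b ≡ true → b' ≡ true) → indicator b ≤ indicator b'
indicator-mono {false}      _ = z≤n
indicator-mono {true}  {b'} h rewrite h refl = ≤-refl

indicator≤1 : ∀ b → indicator b ≤ 1
indicator≤1 true  = ≤-refl
indicator≤1 false = z≤n

count-mono : ∀ n {t t' : Fin n → Bool} → (∀ i → t i ≡ true → t' i ≡ true) → count n t ≤ count n t'
count-mono zero    h = z≤n
count-mono (suc n) h = +-mono-≤ (indicator-mono (h zero)) (count-mono n (h ∘ suc))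

count-strict : ∀ n {t t' : Fin n → Bool} → (∀ i → t i ≡ true → t' i ≡ true) →
               ∀ i → t i ≡ false → t' i ≡ true → count n t < count n t'
count-strict (suc n) {t} {t'} h zero    ti ti' rewrite ti | ti' = s≤s (count-mono n (h ∘ suc))
count-strict (suc n) {t} {t'} h (suc i) ti ti' = begin-strict
  indicator (t zero) + count n (t ∘ suc)   <⟨ +-mono-≤-< (indicator-mono (h zero)) (count-strict n (h ∘ suc) i ti ti') ⟩
  indicator (t' zero) + count n (t' ∘ suc) ∎
  where open ≤-Reasoning

swap-ends : ∀ x c y → x + c + y ≡ y + c + x
swap-ends x c y = begin
  x + c + y   ≡⟨ +-comm (x + c) y ⟩
  y + (x + c) ≡⟨ cong (y +_) (+-comm x c) ⟩
  y + (c + x) ≡⟨ +-assoc y c x ⟨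
  y + c + x   ∎
  where open ≡-Reasoning

count-update : ∀ n (t t' : Fin n → Bool) i → (∀ j → j ≢ i → t j ≡ t' j) →
               count n t + indicator (t' i) ≡ count n t' + indicator (t i)
count-update (suc n) t t' zero h
  rewrite count-cong n {t ∘ suc} {t' ∘ suc} (λ j → h (suc j) (λ ())) =
  swap-ends (indicator (t zero)) (count n (t' ∘ suc)) (indicator (t' zero))
count-update (suc n) t t' (suc i) h rewrite h zero (λ ()) = begin
  x + count n (t ∘ suc) + indicator (t' (suc i))   ≡⟨ +-assoc x _ _ ⟩
  x + (count n (t ∘ suc) + indicator (t' (suc i))) ≡⟨ cong (x +_) (count-update n (t ∘ suc) (t' ∘ suc) i tails-agree) ⟩
  x + (count n (t' ∘ suc) + indicator (t (suc i))) ≡⟨ +-assoc x _ _ ⟨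
  x + count n (t' ∘ suc) + indicator (t (suc i))   ∎
  where
  open ≡-Reasoning
  x = indicator (t' zero)
  tails-agree : ∀ j → j ≢ i → t (suc j) ≡ t' (suc j)
  tails-agree j j≢i = h (suc j) (j≢i ∘ FinP.suc-injective)

count≤ : ∀ n t → count n t ≤ n
count≤ zero    t = z≤n
count≤ (suc n) t = +-mono-≤ (indicator≤1 (t zero)) (count≤ n (t ∘ suc))

count-none : ∀ n t → (∀ i → t i ≡ false) → count n t ≡ 0
count-none zero    t h = refl
count-none (suc n) t h rewrite h zero = count-none n (t ∘ suc) (h ∘ suc)

Evenℕ Oddℕ : ℕ → Set
Evenℕ n = n % 2 ≡ 0
Oddℕ  n = n % 2 ≡ 1

parity : ∀ n → Evenℕ n ⊎ Oddℕ n
parity zero          = inj₁ refl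
parity (suc zero)    = inj₂ refl
parity (suc (suc n)) = parity n

even⇒odd-suc : ∀ n → Evenℕ n → Oddℕ (suc n)
even⇒odd-suc zero          h = refl
even⇒odd-suc (suc zero)    ()
even⇒odd-suc (suc (suc n)) h = even⇒odd-suc n h

odd⇒even-suc : ∀ n → Oddℕ n → Evenℕ (suc n)
odd⇒even-suc zero          ()
odd⇒even-suc (suc zero)    h = refl
odd⇒even-suc (suc (suc n)) h = odd⇒even-suc n h

even-odd-disjoint : ∀ n → Evenℕ n → Oddℕ n → ⊥
even-odd-disjoint n e o with trans (sym e) o
... | ()

odd-suc⇒even : ∀ n → Oddℕ (suc n) → Evenℕ n
odd-suc⇒even n h with parity n
... | inj₁ e = e
... | inj₂ o = ⊥-elim (even-odd-disjoint (suc n) (odd⇒even-suc n o) h)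

odd⇒positive : ∀ n → Oddℕ n → 0 < n
odd⇒positive (suc n) _ = s≤s z≤n

module _ {nA nP : ℕ} where

  msize : Assignment nA nP → ℕ
  msize m = count nA (is-just ∘ m)

  -- (the test inside `size` is only reachable through unification, so the
  -- pointwise equation is stated before and proved after its use)
  module _ (m : Assignment nA nP) where
    size-pointwise : ∀ a → _ ≡ is-just (m a)

    size≡msize : size m ≡ msize m
    size≡msize = countB-as-count size-pointwise

    size-pointwise a with m a
    ... | just _  = refl
    ... | nothing = refl

  maximum-intro : ∀ {K : BGraph nA nP} {m} → IsMatching K m →
                  (∀ m' → IsMatching K m' → msize m' ≤ msize m) → IsMaximumMatching K m
  maximum-intro {m = m} mM h =
    mM , λ m' m'M → subst₂ _≤_ (sym (size≡msize m')) (sym (size≡msize m)) (h m' m'M)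

  maximum-bound : ∀ {K : BGraph nA nP} {m} → IsMaximumMatching K m →
                  ∀ m' → IsMatching K m' → msize m' ≤ msize m
  maximum-bound {m = m} (_ , h) m' m'M = subst₂ _≤_ (size≡msize m') (size≡msize m) (h m' m'M)

  maximum-≥ : ∀ {K : BGraph nA nP} {m m'} → IsMaximumMatching K m → IsMatching K m' →
              msize m ≤ msize m' → IsMaximumMatching K m'
  maximum-≥ mMax m'M le = maximum-intro m'M (λ z zM → ≤-trans (maximum-bound mMax z zM) le)

  _[_↦_] : Assignment nA nP → Fin nA → Maybe (Fin nP) → Assignment nA nP
  (m [ a ↦ v ]) x with x Fin.≟ a
  ... | yes _ = v
  ... | no  _ = m x

  ↦-same : ∀ m a v → (m [ a ↦ v ]) a ≡ v
  ↦-same m a v with a Fin.≟ a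
  ... | yes _   = refl
  ... | no  a≢a = ⊥-elim (a≢a refl)

  ↦-other : ∀ m a v x → x ≢ a → (m [ a ↦ v ]) x ≡ m x
  ↦-other m a v x x≢a with x Fin.≟ a
  ... | yes x≡a = ⊥-elim (x≢a x≡a)
  ... | no  _   = refl

  msize-↦ : ∀ m a v → msize m + indicator (is-just v) ≡ msize (m [ a ↦ v ]) + indicator (is-just (m a))
  msize-↦ m a v =
    subst (λ w → msize m + indicator (is-just w) ≡ msize (m [ a ↦ v ]) + indicator (is-just (m a)))
          (↦-same m a v)
          (count-update nA _ _ a (λ x x≢a → cong is-just (sym (↦-other m a v x x≢a))))

  msize-match : ∀ m a {q} → m a ≡ nothing → suc (msize m) ≡ msize (m [ a ↦ just q ])
  msize-match m a {q} ma = trans (+-comm 1 (msize m))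
    (trans (msize-↦ m a (just q))
           (trans (cong (λ w → msize (m [ a ↦ just q ]) + indicator (is-just w)) ma) (+-identityʳ _)))

  msize-unmatch : ∀ m a {q} → m a ≡ just q → msize m ≡ suc (msize (m [ a ↦ nothing ]))
  msize-unmatch m a ma = trans (sym (+-identityʳ _))
    (trans (msize-↦ m a nothing)
           (trans (cong (λ w → msize (m [ a ↦ nothing ]) + indicator (is-just w)) ma) (+-comm _ 1)))

  msize-rematch : ∀ m a {q q'} → m a ≡ just q' → msize m ≡ msize (m [ a ↦ just q ])
  msize-rematch m a {q} ma =
    +-cancelʳ-≡ 1 _ _
      (trans (msize-↦ m a (just q)) (cong (λ w → msize (m [ a ↦ just q ]) + indicator (is-just w)) ma))

  unmatch-matching : ∀ {K : BGraph nA nP} {m} a → IsMatching K m → IsMatching K (m [ a ↦ nothing ])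
  unmatch-matching {K} {m} a (edges , injective) = edges' , injective'
    where
    edges' : ∀ x r → (m [ a ↦ nothing ]) x ≡ just r → K x r
    edges' x r h with x Fin.≟ a
    edges' x r () | yes _
    ... | no _ = edges x r h
    injective' : ∀ x x' r → (m [ a ↦ nothing ]) x ≡ just r → (m [ a ↦ nothing ]) x' ≡ just r → x ≡ x'
    injective' x x' r h h' with x Fin.≟ a | x' Fin.≟ a
    injective' x x' r () h' | yes _ | _
    injective' x x' r h () | no _  | yes _
    ... | no _ | no _ = injective x x' r h h'

  match-matching : ∀ {K : BGraph nA nP} {m} a r → IsMatching K m → K a r →
                   (∀ x → x ≢ a → m x ≢ just r) → IsMatching K (m [ a ↦ just r ])
  match-matching {K} {m} a r (edges , injective) Kar r-free = edges' , injective'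
    where
    edges' : ∀ x r' → (m [ a ↦ just r ]) x ≡ just r' → K x r'
    edges' x r' h with x Fin.≟ a
    edges' x .r refl | yes refl = Kar
    ... | no _ = edges x r' h
    injective' : ∀ x x' r' → (m [ a ↦ just r ]) x ≡ just r' → (m [ a ↦ just r ]) x' ≡ just r' → x ≡ x'
    injective' x x' r' h h' with x Fin.≟ a | x' Fin.≟ a
    ... | yes x≡a | yes x'≡a = trans x≡a (sym x'≡a)
    injective' x x' r' refl h' | yes _ | no x'≢a = ⊥-elim (r-free x' x'≢a h')
    injective' x x' r' h refl | no x≢a | yes _ = ⊥-elim (r-free x x≢a h)
    ... | no _ | no _ = injective x x' r' h h'

-- Alternating paths.  For the flipping argument it is convenient to index the
-- vertices of a path by ℕ instead of Fin (suc k); `AltPathℕ` is this form of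
-- `AltPath`, and `toAltPathℕ` converts.

module _ {nA nP : ℕ} where

  _≟V_ : (u v : Vertex nA nP) → Dec (u ≡ v)
  _≟V_ = SumP.≡-dec Fin._≟_ Fin._≟_

  record AltPathℕ (K : BGraph nA nP) (m : Assignment nA nP) (k : ℕ) : Set where
    field
      vertex      : ℕ → Vertex nA nP
      injective   : ∀ {i j} → i ≤ k → j ≤ k → vertex i ≡ vertex j → i ≡ j
      start-free  : Unmatched m (vertex 0)
      adjacent    : ∀ e → e < k → Adj K (vertex e) (vertex (suc e))
      matched⇒odd : ∀ e → e < k → InM m (vertex e) (vertex (suc e)) → Oddℕ e
      odd⇒matched : ∀ e → e < k → Oddℕ e → InM m (vertex e) (vertex (suc e))

  module _ {K : BGraph nA nP} {m : Assignment nA nP} {k : ℕ} (P : AltPath K m k) where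
    open AltPath P

    private
      vertexℕ : ℕ → Vertex nA nP
      vertexℕ n with n <? suc k
      ... | yes n<  = π (fromℕ< n<)
      ... | no  _   = π zero

      vertexℕ-at : ∀ n (i : Fin (suc k)) → toℕ i ≡ n → vertexℕ n ≡ π i
      vertexℕ-at n i eq with n <? suc k
      ... | yes n< = cong π (FinP.toℕ-injective (trans (FinP.toℕ-fromℕ< n<) (sym eq)))
      ... | no  n≮ = ⊥-elim (n≮ (subst (_< suc k) eq (FinP.toℕ<n i)))

      at-index : ∀ n (n< : n < suc k) → vertexℕ n ≡ π (fromℕ< n<)
      at-index n n< = vertexℕ-at n (fromℕ< n<) (FinP.toℕ-fromℕ< n<)

      at-edge-start : ∀ e (e< : e < k) → vertexℕ e ≡ π (inject₁ (fromℕ< e<))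
      at-edge-start e e< = vertexℕ-at e _ (trans (FinP.toℕ-inject₁ (fromℕ< e<)) (FinP.toℕ-fromℕ< e<))

      at-edge-end : ∀ e (e< : e < k) → vertexℕ (suc e) ≡ π (suc (fromℕ< e<))
      at-edge-end e e< = vertexℕ-at (suc e) _ (cong suc (FinP.toℕ-fromℕ< e<))

      odd-index : ∀ e (e< : e < k) → Oddℕ (toℕ (fromℕ< e<)) ≡ Oddℕ e
      odd-index e e< = cong Oddℕ (FinP.toℕ-fromℕ< e<)

    toAltPathℕ : AltPathℕ K m k
    toAltPathℕ = record
      { vertex      = vertexℕ
      ; injective   = λ {i} {j} i≤ j≤ eq →
          trans (sym (FinP.toℕ-fromℕ< (s≤s i≤)))
            (trans (cong toℕ (simple (trans (sym (at-index i (s≤s i≤))) (trans eq (at-index j (s≤s j≤))))))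
                   (FinP.toℕ-fromℕ< (s≤s j≤)))
      ; start-free  = subst (Unmatched m) (sym (vertexℕ-at 0 zero refl)) start
      ; adjacent    = λ e e< → subst₂ (Adj K) (sym (at-edge-start e e<)) (sym (at-edge-end e e<))
                                 (adjacent (fromℕ< e<))
      ; matched⇒odd = λ e e< h → subst id (odd-index e e<)
          (proj₁ (alternate (fromℕ< e<)) (subst₂ (InM m) (at-edge-start e e<) (at-edge-end e e<) h))
      ; odd⇒matched = λ e e< h → subst₂ (InM m) (sym (at-edge-start e e<)) (sym (at-edge-end e e<))
          (proj₂ (alternate (fromℕ< e<)) (subst id (sym (odd-index e e<)) h))
      }

    toAltPathℕ-end : ∀ {v} → endpoint ≡ v → AltPathℕ.vertex toAltPathℕ k ≡ v
    toAltPathℕ-end = trans (vertexℕ-at k (fromℕ k) (FinP.toℕ-fromℕ k))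

  module _ {K : BGraph nA nP} {m : Assignment nA nP} {k : ℕ} (P : AltPathℕ K m k) where
    open AltPathℕ P

    post-start⇒applicants-odd : ∀ {u} → vertex 0 ≡ inj₂ u → ∀ n → n ≤ k →
      (Evenℕ n → ∃ λ q → vertex n ≡ inj₂ q) × (Oddℕ n → ∃ λ a → vertex n ≡ inj₁ a)
    post-start⇒applicants-odd {u} v0 zero _ = (λ _ → u , v0) , (λ ())
    post-start⇒applicants-odd v0 (suc n) sn≤k with post-start⇒applicants-odd v0 n (<⇒≤ sn≤k) | parity n
    ... | ih | inj₁ en =
      (λ esn → ⊥-elim (even-odd-disjoint (suc n) esn (even⇒odd-suc n en))) , (λ _ → next (proj₁ ih en))
      where
      next : (∃ λ q → vertex n ≡ inj₂ q) → ∃ λ a → vertex (suc n) ≡ inj₁ a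
      next (q , vn) with vertex (suc n) | adjacent n sn≤k
      ... | inj₁ a  | _   = a , refl
      ... | inj₂ q' | adj = ⊥-elim (subst (λ w → Adj K w (inj₂ q')) vn adj)
    ... | ih | inj₂ on =
      (λ _ → next (proj₂ ih on)) , (λ osn → ⊥-elim (even-odd-disjoint (suc n) (odd⇒even-suc n on) osn))
      where
      next : (∃ λ a → vertex n ≡ inj₁ a) → ∃ λ q → vertex (suc n) ≡ inj₂ q
      next (a , vn) with vertex (suc n) | adjacent n sn≤k
      ... | inj₂ q  | _   = q , refl
      ... | inj₁ a' | adj = ⊥-elim (subst (λ w → Adj K w (inj₁ a')) vn adj)

  edgePost : Vertex nA nP → Vertex nA nP → Maybe (Fin nP)
  edgePost (inj₂ q) _        = just q
  edgePost (inj₁ _) (inj₂ q) = just q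
  edgePost (inj₁ _) (inj₁ _) = nothing

  edgePost-adj : ∀ {K : BGraph nA nP} {u v a} → Adj K u v → (u ≡ inj₁ a ⊎ v ≡ inj₁ a) →
                 Σ (Fin nP) λ q → edgePost u v ≡ just q × K a q × (u ≡ inj₂ q ⊎ v ≡ inj₂ q)
  edgePost-adj {u = inj₁ _} {inj₂ q} adj (inj₁ refl) = q , refl , adj , inj₂ refl
  edgePost-adj {u = inj₂ q} {inj₁ _} adj (inj₂ refl) = q , refl , adj , inj₁ refl
  edgePost-adj {u = inj₁ _} {inj₂ _} _ (inj₂ ())
  edgePost-adj {u = inj₂ _} {inj₁ _} _ (inj₁ ())
  edgePost-adj {u = inj₁ _} {inj₁ _} () _
  edgePost-adj {u = inj₂ _} {inj₂ _} () _

  matched-to-post : ∀ {m : Assignment nA nP} {u q} → InM m u (inj₂ q) ⊎ InM m (inj₂ q) u →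
                    Σ (Fin nA) λ b → u ≡ inj₁ b × m b ≡ just q
  matched-to-post {u = inj₁ b} (inj₁ h) = b , refl , h
  matched-to-post {u = inj₁ b} (inj₂ h) = b , refl , h

  -- Flipping m along an alternating path: every applicant on a non-matching
  -- (even-indexed) edge of the path is reassigned to the post of that edge.
  -- This is again a matching provided the path ends at a post (even length)
  -- or at an m-free vertex (odd length).
  module Flip {K : BGraph nA nP} {m : Assignment nA nP} (mM : IsMatching K m) {k : ℕ}
              (P : AltPathℕ K m k)
              (end-post : Evenℕ k → ∀ a → AltPathℕ.vertex P k ≢ inj₁ a)
              (end-free : Oddℕ k → Unmatched m (AltPathℕ.vertex P k)) where
    open AltPathℕ P

    OnEdge : Fin nA → ℕ → Set
    OnEdge a e = vertex e ≡ inj₁ a ⊎ vertex (suc e) ≡ inj₁ a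

    Rematched : Fin nA → Set
    Rematched a = ∃ λ e → e < k × Evenℕ e × OnEdge a e

    rematched? : ∀ a → Dec (Rematched a)
    rematched? a = anyUpTo? (λ e → (e % 2 ≟ 0) ×-dec ((vertex e ≟V inj₁ a) ⊎-dec (vertex (suc e) ≟V inj₁ a))) k

    flipped : Assignment nA nP
    flipped a with rematched? a
    ... | yes (e , _) = edgePost (vertex e) (vertex (suc e))
    ... | no  _       = m a

    flipped-view : ∀ a →
      (Σ ℕ λ e → e < k × Evenℕ e × OnEdge a e × flipped a ≡ edgePost (vertex e) (vertex (suc e)))
      ⊎ (¬ Rematched a × flipped a ≡ m a)
    flipped-view a with rematched? a
    ... | yes (e , e< , ee , on) = inj₁ (e , e< , ee , on , refl)
    ... | no  ¬r                 = inj₂ (¬r , refl)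

    -- If a post on the path is matched in m, its partner is rematched: the
    -- partner is the neighbour across the (odd-indexed) matching edge, which
    -- precedes the post when it sits at an even position and follows it otherwise.
    partner-before : ∀ y q b → suc y ≤ k → Oddℕ y → vertex (suc y) ≡ inj₂ q → m b ≡ just q → Rematched b
    partner-before zero    q b _ () _ _
    partner-before (suc z) q b sy≤k oy vx mb
      with matched-to-post (inj₁ (subst (InM m (vertex (suc z))) vx (odd⇒matched (suc z) sy≤k oy)))
    ... | b' , vz , mb' rewrite proj₂ mM b b' q mb mb' = z , <⇒≤ sy≤k , odd-suc⇒even z oy , inj₂ vz

    partner-after : ∀ y q b → suc y ≤ k → Evenℕ y → vertex (suc y) ≡ inj₂ q → m b ≡ just q → Rematched b
    partner-after y q b sy≤k ey vx mb with m≤n⇒m<n∨m≡n sy≤k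
    ... | inj₂ sy≡k = ⊥-elim (subst (Unmatched m) vx
                        (subst (λ z → Unmatched m (vertex z)) (sym sy≡k)
                           (end-free (subst Oddℕ sy≡k (even⇒odd-suc y ey)))) b mb)
    ... | inj₁ sy<k
          with matched-to-post (inj₂ (subst (λ u → InM m u (vertex (suc (suc y)))) vx
                                        (odd⇒matched (suc y) sy<k (even⇒odd-suc y ey))))
    ...   | b' , vss , mb' rewrite proj₂ mM b b' q mb mb' with m≤n⇒m<n∨m≡n sy<k
    ...     | inj₁ ssy<k = suc (suc y) , ssy<k , odd⇒even-suc (suc y) (even⇒odd-suc y ey) , inj₁ vss
    ...     | inj₂ ssy≡k = ⊥-elim (end-post (subst Evenℕ ssy≡k ey) b' (trans (cong vertex (sym ssy≡k)) vss))

    partner-rematched : ∀ x q b → x ≤ k → vertex x ≡ inj₂ q → m b ≡ just q → Rematched b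
    partner-rematched zero    q b _ vx mb = ⊥-elim (subst (Unmatched m) vx start-free b mb)
    partner-rematched (suc y) q b sy≤k vx mb with parity y
    ... | inj₁ ey = partner-after  y q b sy≤k ey vx mb
    ... | inj₂ oy = partner-before y q b sy≤k oy vx mb

    PostOn : Fin nP → ℕ → Set
    PostOn q e = vertex e ≡ inj₂ q ⊎ vertex (suc e) ≡ inj₂ q

    post-on-unique : ∀ {q e e'} → e < k → e' < k → Evenℕ e → Evenℕ e' → PostOn q e → PostOn q e' → e ≡ e'
    post-on-unique l l' _ _ (inj₁ x) (inj₁ y) = injective (<⇒≤ l) (<⇒≤ l') (trans x (sym y))
    post-on-unique {e = e} {e'} l l' ee ee' (inj₁ x) (inj₂ y) =
      ⊥-elim (even-odd-disjoint e ee (subst Oddℕ (sym (injective (<⇒≤ l) l' (trans x (sym y)))) (even⇒odd-suc e' ee')))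
    post-on-unique {e = e} {e'} l l' ee ee' (inj₂ x) (inj₁ y) =
      ⊥-elim (even-odd-disjoint e' ee' (subst Oddℕ (injective l (<⇒≤ l') (trans x (sym y))) (even⇒odd-suc e ee)))
    post-on-unique l l' _ _ (inj₂ x) (inj₂ y) = suc-injective (injective l l' (trans x (sym y)))

    applicant-on-edge-unique : ∀ {a a' e} → e < k → OnEdge a e → OnEdge a' e → a ≡ a'
    applicant-on-edge-unique _ (inj₁ x) (inj₁ y) = SumP.inj₁-injective (trans (sym x) y)
    applicant-on-edge-unique {e = e} l (inj₁ x) (inj₂ y) = ⊥-elim (subst₂ (Adj K) x y (adjacent e l))
    applicant-on-edge-unique {e = e} l (inj₂ x) (inj₁ y) = ⊥-elim (subst₂ (Adj K) y x (adjacent e l))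
    applicant-on-edge-unique _ (inj₂ x) (inj₂ y) = SumP.inj₁-injective (trans (sym x) y)

    rematched-edge : ∀ {a q e} → e < k → OnEdge a e → flipped a ≡ edgePost (vertex e) (vertex (suc e)) →
                     flipped a ≡ just q → K a q × PostOn q e
    rematched-edge {e = e} l on eq h with edgePost-adj {K = K} (adjacent e l) on
    ... | q' , post≡ , Kaq' , on' with MaybeP.just-injective (trans (sym h) (trans eq post≡))
    ... | refl = Kaq' , on'

    post-position : ∀ {q e} → e < k → PostOn q e → Σ ℕ λ x → x ≤ k × vertex x ≡ inj₂ q
    post-position {e = e} l (inj₁ x) = e , <⇒≤ l , x
    post-position {e = e} l (inj₂ x) = suc e , l , x

    -- Posts of even edges are distinct, and a post is taken from its m-partner
    -- only when that partner is itself rematched.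
    flipped-matching : IsMatching K flipped
    flipped-matching = edges , injective'
      where
      edges : ∀ a q → flipped a ≡ just q → K a q
      edges a q h with flipped-view a
      ... | inj₁ (e , l , _ , on , eq) = proj₁ (rematched-edge l on eq h)
      ... | inj₂ (_ , eq)              = proj₁ mM a q (trans (sym eq) h)
      injective' : ∀ a a' q → flipped a ≡ just q → flipped a' ≡ just q → a ≡ a'
      injective' a a' q h h' with flipped-view a | flipped-view a'
      ... | inj₁ (e , l , ee , on , eq) | inj₁ (e' , l' , ee' , on' , eq')
            with post-on-unique l l' ee ee' (proj₂ (rematched-edge l on eq h)) (proj₂ (rematched-edge l' on' eq' h'))
      ...   | refl = applicant-on-edge-unique l on on'
      injective' a a' q h h' | inj₁ (e , l , _ , on , eq) | inj₂ (¬r' , eq')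
            with post-position l (proj₂ (rematched-edge l on eq h))
      ...   | x , x≤k , vx = ⊥-elim (¬r' (partner-rematched x q a' x≤k vx (trans (sym eq') h')))
      injective' a a' q h h' | inj₂ (¬r , eq) | inj₁ (e' , l' , _ , on' , eq')
            with post-position l' (proj₂ (rematched-edge l' on' eq' h'))
      ...   | x , x≤k , vx = ⊥-elim (¬r (partner-rematched x q a x≤k vx (trans (sym eq) h)))
      injective' a a' q h h' | inj₂ (_ , eq) | inj₂ (_ , eq') =
        proj₂ mM a a' q (trans (sym eq) h) (trans (sym eq') h')

    flipped-keeps-matched : ∀ a → is-just (m a) ≡ true → is-just (flipped a) ≡ true
    flipped-keeps-matched a h with flipped-view a
    ... | inj₂ (_ , eq) = trans (cong is-just eq) h
    ... | inj₁ (e , l , _ , on , eq) with edgePost-adj {K = K} (adjacent e l) on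
    ...   | _ , post≡ , _ = cong is-just (trans eq post≡)

    flipped-size : msize m ≤ msize flipped
    flipped-size = count-mono nA flipped-keeps-matched

    flipped-augments : ∀ a₀ → 0 < k → vertex 0 ≡ inj₁ a₀ → msize m < msize flipped
    flipped-augments a₀ l v0 with flipped-view a₀
    ... | inj₂ (¬r , _) = ⊥-elim (¬r (0 , l , refl , inj₁ v0))
    ... | inj₁ (e , l' , _ , on , eq) with edgePost-adj {K = K} (adjacent e l') on
    ...   | _ , post≡ , _ = count-strict nA flipped-keeps-matched a₀
                               (cong is-just (subst (Unmatched m) v0 start-free)) (cong is-just (trans eq post≡))

    flipped-frees-end : ∀ p → Evenℕ k → vertex k ≡ inj₂ p → ∀ a → flipped a ≢ just p
    flipped-frees-end p ek vk a h with flipped-view a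
    ... | inj₂ (¬r , eq) = ¬r (partner-rematched k p a ≤-refl vk (trans (sym eq) h))
    ... | inj₁ (e , l , ee , on , eq) with proj₂ (rematched-edge l on eq h)
    ...   | inj₁ ve  = <⇒≢ l (injective (<⇒≤ l) ≤-refl (trans ve (sym vk)))
    ...   | inj₂ vse = even-odd-disjoint k ek (subst Oddℕ (injective l ≤-refl (trans vse (sym vk))) (even⇒odd-suc e ee))

  module _ {K : BGraph nA nP} where

    no-augmenting-path : ∀ {m k p} → IsMaximumMatching K m → (P : AltPathℕ K m k) → Oddℕ k →
                         AltPathℕ.vertex P k ≡ inj₂ p → Unmatched m (inj₂ {A = Fin nA} p) → ⊥
    no-augmenting-path {m} {k} {p} mMax P ok vk p-free with AltPathℕ.vertex P 0 in v0
    ... | inj₂ _ with proj₂ (post-start⇒applicants-odd P v0 k ≤-refl) ok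
    ...   | a , vk' with trans (sym vk) vk'
    ...     | ()
    no-augmenting-path {m} {k} {p} mMax P ok vk p-free | inj₁ a₀ =
      <⇒≱ (flipped-augments a₀ (odd⇒positive k ok) v0) (maximum-bound mMax flipped flipped-matching)
      where
      open Flip (proj₁ mMax) P (λ ek → ⊥-elim (even-odd-disjoint k ek ok))
                               (λ _ → subst (Unmatched m) (sym vk) p-free)

    free-by-flip : ∀ {m k p} → IsMaximumMatching K m → (P : AltPathℕ K m k) → Evenℕ k →
                   AltPathℕ.vertex P k ≡ inj₂ p →
                   Σ (Assignment nA nP) λ m' → IsMaximumMatching K m' × Unmatched m' (inj₂ {A = Fin nA} p)
    free-by-flip {m} {k} {p} mMax P ek vk =
      flipped , maximum-≥ mMax flipped-matching flipped-size , flipped-frees-end p ek vk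
      where
      post≢applicant : ∀ {a} → inj₂ p ≢ inj₁ a
      post≢applicant ()
      open Flip (proj₁ mMax) P (λ _ a vk≡a → post≢applicant (trans (sym vk) vk≡a))
                               (λ ok → ⊥-elim (even-odd-disjoint k ek ok))

    free⇒even : ∀ {m p} → Unmatched m (inj₂ {A = Fin nA} p) → IsEven K m (inj₂ p)
    free⇒even {m} {p} p-free =
      0 , record { π = λ _ → inj₂ p ; simple = λ {x} {y} _ → Fin1-unique x y ; start = p-free
                 ; adjacent = λ () ; alternate = λ () } , refl , refl
      where
      Fin1-unique : (x y : Fin 1) → x ≡ y
      Fin1-unique zero zero = refl

  -- Alternating paths are simple, so their length is below
  -- the number of vertices, and for each length the candidate vertex
  -- sequences form a finite, exhaustively searchable set.

  any-vertex? : (R : Vertex nA nP → Set) → (∀ v → Dec (R v)) → Dec (∃ R)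
  any-vertex? R R? with FinP.any? (R? ∘ inj₁) | FinP.any? (R? ∘ inj₂)
  ... | yes (a , r) | _           = yes (inj₁ a , r)
  ... | no _        | yes (p , r) = yes (inj₂ p , r)
  ... | no ¬a       | no ¬p       = no λ { (inj₁ a , r) → ¬a (a , r) ; (inj₂ p , r) → ¬p (p , r) }

  _◃_ : ∀ {n} → Vertex nA nP → (Fin n → Vertex nA nP) → Fin (suc n) → Vertex nA nP
  (x ◃ g) zero    = x
  (x ◃ g) (suc i) = g i

  any-sequence? : ∀ n (Q : (Fin n → Vertex nA nP) → Set) →
                  (∀ π π' → (∀ i → π i ≡ π' i) → Q π → Q π') → (∀ π → Dec (Q π)) → Dec (∃ Q)
  any-sequence? zero Q resp Q? with Q? (λ ())
  ... | yes q = yes (_ , q)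
  ... | no ¬q = no λ { (π , q) → ¬q (resp π _ (λ ()) q) }
  any-sequence? (suc n) Q resp Q?
    with any-vertex? (λ x → ∃ λ g → Q (x ◃ g))
           (λ x → any-sequence? n (λ g → Q (x ◃ g))
                    (λ π π' eq → resp _ _ (λ { zero → refl ; (suc i) → eq i })) (λ g → Q? (x ◃ g)))
  ... | yes (x , g , q) = yes (x ◃ g , q)
  ... | no ¬q = no λ { (π , q) → ¬q (π zero , π ∘ suc , resp π _ (λ { zero → refl ; (suc i) → refl }) q) }

  module _ (K : BGraph nA nP) (K? : ∀ a p → Dec (K a p)) (m : Assignment nA nP) where

    adj? : ∀ u v → Dec (Adj K u v)
    adj? (inj₁ a) (inj₂ p) = K? a p
    adj? (inj₂ p) (inj₁ a) = K? a p
    adj? (inj₁ _) (inj₁ _) = no λ ()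
    adj? (inj₂ _) (inj₂ _) = no λ ()

    inM? : ∀ u v → Dec (InM m u v)
    inM? (inj₁ a) (inj₂ p) = MaybeP.≡-dec Fin._≟_ (m a) (just p)
    inM? (inj₂ p) (inj₁ a) = MaybeP.≡-dec Fin._≟_ (m a) (just p)
    inM? (inj₁ _) (inj₁ _) = no λ ()
    inM? (inj₂ _) (inj₂ _) = no λ ()

    unmatched? : ∀ v → Dec (Unmatched m v)
    unmatched? (inj₁ a) = MaybeP.≡-dec Fin._≟_ (m a) nothing
    unmatched? (inj₂ p) = FinP.all? (λ a → ¬? (MaybeP.≡-dec Fin._≟_ (m a) (just p)))

    IsAltPathTo : ∀ k → Vertex nA nP → (Fin (suc k) → Vertex nA nP) → Set
    IsAltPathTo k v π =
      (∀ x y → π x ≡ π y → x ≡ y) × Unmatched m (π zero) ×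
      (∀ (i : Fin k) → Adj K (π (inject₁ i)) (π (suc i))) ×
      (∀ (i : Fin k) → (InM m (π (inject₁ i)) (π (suc i)) → toℕ i % 2 ≡ 1) ×
                        (toℕ i % 2 ≡ 1 → InM m (π (inject₁ i)) (π (suc i)))) ×
      (π (fromℕ k) ≡ v)

    IsAltPathTo-resp : ∀ k v π π' → (∀ i → π i ≡ π' i) → IsAltPathTo k v π → IsAltPathTo k v π'
    IsAltPathTo-resp k v π π' eq (simple , start , adjacent , alternate , end) =
      (λ x y e → simple x y (trans (eq x) (trans e (sym (eq y))))) ,
      subst (Unmatched m) (eq zero) start ,
      (λ i → subst₂ (Adj K) (eq _) (eq _) (adjacent i)) ,
      (λ i → (λ h → proj₁ (alternate i) (subst₂ (InM m) (sym (eq _)) (sym (eq _)) h)) ,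
             (λ h → subst₂ (InM m) (eq _) (eq _) (proj₂ (alternate i) h))) ,
      trans (sym (eq _)) end

    isAltPathTo? : ∀ k v π → Dec (IsAltPathTo k v π)
    isAltPathTo? k v π =
      FinP.all? (λ x → FinP.all? (λ y → (π x ≟V π y) →-dec (x Fin.≟ y))) ×-dec
      unmatched? (π zero) ×-dec
      FinP.all? (λ i → adj? (π (inject₁ i)) (π (suc i))) ×-dec
      FinP.all? (λ i → (inM? (π (inject₁ i)) (π (suc i)) →-dec (toℕ i % 2 ≟ 1)) ×-dec
                        ((toℕ i % 2 ≟ 1) →-dec inM? (π (inject₁ i)) (π (suc i)))) ×-dec
      (π (fromℕ k) ≟V v)

    OddPathOfLength : ℕ → Vertex nA nP → Set
    OddPathOfLength k v = Σ (AltPath K m k) λ P → (k % 2 ≡ 1) × (AltPath.endpoint P ≡ v)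

    oddPathOfLength? : ∀ k v → Dec (OddPathOfLength k v)
    oddPathOfLength? k v with k % 2 ≟ 1
    ... | no ¬ok = no λ { (_ , ok , _) → ¬ok ok }
    ... | yes ok with any-sequence? (suc k) (IsAltPathTo k v) (IsAltPathTo-resp k v) (isAltPathTo? k v)
    ...   | yes (π , simple , start , adjacent , alternate , end) =
            yes (record { π = π ; simple = λ {x} {y} → simple x y ; start = start
                        ; adjacent = adjacent ; alternate = alternate } , ok , end)
    ...   | no ¬path = no λ { (P , _ , end) →
              ¬path (AltPath.π P , (λ x y → AltPath.simple P) , AltPath.start P ,
                     AltPath.adjacent P , AltPath.alternate P , end) }

    length-bound : ∀ {k} → AltPath K m k → k < nA + nP
    length-bound P = FinP.injective⇒≤ {f = join nA nP ∘ AltPath.π P} λ eq →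
      AltPath.simple P (trans (sym (FinP.splitAt-join nA nP _))
                              (trans (cong (splitAt nA) eq) (FinP.splitAt-join nA nP _)))

    isOdd? : ∀ v → Dec (IsOdd K m v)
    isOdd? v with anyUpTo? (λ k → oddPathOfLength? k v) (nA + nP)
    ... | yes (k , _ , path) = yes (k , path)
    ... | no ¬path = no λ { (k , P , ok , end) → ¬path (k , length-bound P , P , ok , end) }

  -- O(K) ∪ U(K) consists of exactly the posts covered by every maximum
  -- matching: a free post is even and, by Berge, not odd; conversely an even
  -- post can be freed by flipping an even path.

  CoveredByAllMaximum : BGraph nA nP → Fin nP → Set
  CoveredByAllMaximum K p = ∀ m → IsMaximumMatching K m → ¬ Unmatched m (inj₂ {A = Fin nA} p)

  InOU⇒covered : ∀ {K : BGraph nA nP} {p} → InOU K (inj₂ p) → CoveredByAllMaximum K p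
  InOU⇒covered ou m mMax p-free with ou m mMax
  ... | inj₂ (¬even , _)          = ¬even (free⇒even p-free)
  ... | inj₁ (k , P , ok , end)   =
    no-augmenting-path mMax (toAltPathℕ P) ok (toAltPathℕ-end P end) p-free

  covered⇒InOU : ∀ {K : BGraph nA nP} {p} → (∀ a q → Dec (K a q)) →
                 CoveredByAllMaximum K p → InOU K (inj₂ p)
  covered⇒InOU {K} {p} K? covered m mMax with isOdd? K K? m (inj₂ p)
  ... | yes odd = inj₁ odd
  ... | no ¬odd = inj₂ (¬even , ¬odd)
    where
    ¬even : ¬ IsEven K m (inj₂ p)
    ¬even (k , P , ek , end) with free-by-flip mMax (toAltPathℕ P) ek (toAltPathℕ-end P end)
    ... | m' , m'Max , p-free = covered m' m'Max p-free

  -- If N a₁ = q₀, follow the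
  -- N/Y-alternating chain a₁ -N- q₀ -Y- b₁ -N- q₁ -Y- b₂ …, moving each bᵢ from
  -- its N-post to its Y-post; the chain cannot end at a Y-free post (Y would
  -- then exceed N), so it ends at an N-free applicant.  The chain is walked
  -- step by step, keeping the modified N (`cand`) and a modified Y (`rival`)
  -- agreeing with N on one more applicant after every step.

  module Exchange {K : BGraph nA nP} (N : Assignment nA nP) (N-max : IsMaximumMatching K N)
                  (a₁ : Fin nA) (q₀ : Fin nP) (N-a₁ : N a₁ ≡ just q₀) where

    PostsOfN : Assignment nA nP → Set
    PostsOfN X = ∀ a r → X a ≡ just r → ∃ λ b → N b ≡ just r

    Exchanged : Set
    Exchanged = Σ (Assignment nA nP) λ N' → IsMatching K N' × msize N ≤ msize N' ×
                  N' a₁ ≡ nothing × PostsOfN N'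

    -- The state after freeing a₁ and walking part of the chain: the last
    -- moved applicant `cur` has lost its N-post `post`, which is now free.
    record State : Set where
      field
        cand rival      : Assignment nA nP
        cur             : Fin nA
        post            : Fin nP
        cand-matching   : IsMatching K cand
        rival-matching  : IsMatching K rival
        cand-size       : msize N ≤ suc (msize cand)
        rival-size      : msize N ≤ msize rival
        rival-cur-free  : rival cur ≡ nothing
        post-free       : ∀ a → cand a ≢ just post
        N-cur           : N cur ≡ just post
        cand-a₁-free    : cand a₁ ≡ nothing
        cand-posts      : PostsOfN cand
        cand-differs    : ∀ a → cand a ≢ N a → rival a ≡ N a ⊎ a ≡ cur

    _≟M_ : (x y : Maybe (Fin nP)) → Dec (x ≡ y)
    _≟M_ = MaybeP.≡-dec Fin._≟_

    agreement : Assignment nA nP → ℕ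
    agreement Y = count nA (λ a → does (Y a ≟M N a))

    agrees⇒≡ : ∀ {x y} → does (x ≟M y) ≡ true → x ≡ y
    agrees⇒≡ {x} {y} h with x ≟M y
    ... | yes x≡y = x≡y

    Progress : State → Set
    Progress st = Exchanged ⊎ (Σ State λ st' → agreement (State.rival st) < agreement (State.rival st'))

    -- A step in the situation where the rival matches some applicant b to
    -- `post`: b is then still N-matched in cand, and b is moved to `post`.
    module Step (st : State) (b : Fin nA) (rival-b : State.rival st b ≡ just (State.post st)) where
      open State st

      b≢cur : b ≢ cur
      b≢cur refl with trans (sym rival-b) rival-cur-free
      ... | ()

      cand-b : cand b ≡ N b
      cand-b with cand b ≟M N b
      ... | yes eq = eq
      ... | no  ne with cand-differs b ne
      ...   | inj₂ b≡cur = ⊥-elim (b≢cur b≡cur)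
      ...   | inj₁ eq    = ⊥-elim (b≢cur (proj₂ (proj₁ N-max) b cur post (trans (sym eq) rival-b) N-cur))

      b≢a₁ : b ≢ a₁
      b≢a₁ refl with trans (sym cand-a₁-free) (trans cand-b N-a₁)
      ... | ()

      cand⁺ : Assignment nA nP
      cand⁺ = cand [ b ↦ just post ]

      cand⁺-matching : IsMatching K cand⁺
      cand⁺-matching = match-matching b post cand-matching (proj₁ rival-matching b post rival-b) (λ x _ → post-free x)

      cand⁺-a₁ : cand⁺ a₁ ≡ nothing
      cand⁺-a₁ = trans (↦-other cand b (just post) a₁ (b≢a₁ ∘ sym)) cand-a₁-free

      cand⁺-posts : PostsOfN cand⁺
      cand⁺-posts a r h with a Fin.≟ b
      ... | yes refl = cur , trans N-cur h
      ... | no  _    = cand-posts a r h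

      finish : cand b ≡ nothing → Exchanged
      finish cand-b-free =
        cand⁺ , cand⁺-matching , ≤-trans cand-size (≤-reflexive (msize-match cand b cand-b-free)) ,
        cand⁺-a₁ , cand⁺-posts

      -- Otherwise b loses its post q', and the chain continues from b; the
      -- rival drops b and takes over N's edge at cur.
      module Advance (q' : Fin nP) (cand-b-q' : cand b ≡ just q') where

        post≢q' : post ≢ q'
        post≢q' refl = post-free b cand-b-q'

        N-b : N b ≡ just q'
        N-b = trans (sym cand-b) cand-b-q'

        rival⁻ rival′ : Assignment nA nP
        rival⁻ = rival [ b ↦ nothing ]
        rival′ = rival⁻ [ cur ↦ just post ]

        rival⁻-cur : rival⁻ cur ≡ nothing
        rival⁻-cur = trans (↦-other rival b nothing cur (b≢cur ∘ sym)) rival-cur-free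

        rival′-matching : IsMatching K rival′
        rival′-matching =
          match-matching cur post (unmatch-matching b rival-matching) (proj₁ (proj₁ N-max) cur post N-cur) post-free⁻
          where
          post-free⁻ : ∀ x → x ≢ cur → rival⁻ x ≢ just post
          post-free⁻ x _ h with x Fin.≟ b
          post-free⁻ x _ () | yes _
          ... | no x≢b = x≢b (proj₂ rival-matching x b post h rival-b)

        post-free′ : ∀ a → cand⁺ a ≢ just q'
        post-free′ a h with a Fin.≟ b
        ... | yes refl = post≢q' (MaybeP.just-injective h)
        ... | no a≢b   = a≢b (proj₂ cand-matching a b q' h cand-b-q')

        differs′ : ∀ a → cand⁺ a ≢ N a → rival′ a ≡ N a ⊎ a ≡ b
        differs′ a h with a Fin.≟ b
        ... | yes a≡b = inj₂ a≡b
        ... | no a≢b with a Fin.≟ cur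
        ...   | yes refl = inj₁ (sym N-cur)
        ...   | no a≢cur with cand-differs a h
        ...     | inj₁ eq     = inj₁ (trans (↦-other rival b nothing a a≢b) eq)
        ...     | inj₂ a≡cur = ⊥-elim (a≢cur a≡cur)

        next : State
        next = record
          { cand = cand⁺ ; rival = rival′ ; cur = b ; post = q'
          ; cand-matching  = cand⁺-matching
          ; rival-matching = rival′-matching
          ; cand-size      = subst (λ z → msize N ≤ suc z) (msize-rematch cand b cand-b-q') cand-size
          ; rival-size     = subst (msize N ≤_)
              (trans (msize-unmatch rival b rival-b) (msize-match rival⁻ cur rival⁻-cur)) rival-size
          ; rival-cur-free = trans (↦-other rival⁻ cur (just post) b b≢cur) (↦-same rival b nothing)
          ; post-free      = post-free′
          ; N-cur          = N-b
          ; cand-a₁-free   = cand⁺-a₁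
          ; cand-posts     = cand⁺-posts
          ; cand-differs   = differs′ }

        -- Where the rival agreed with N it still does (b disagreed: its rival
        -- post is `post` ≠ q' = N b), and it now also agrees at cur.
        rival′-agrees : ∀ a → rival a ≡ N a → rival′ a ≡ N a
        rival′-agrees a eq = cases (a Fin.≟ b) (a Fin.≟ cur)
          where
          cases : Dec (a ≡ b) → Dec (a ≡ cur) → rival′ a ≡ N a
          cases (yes a≡b) _ = ⊥-elim (post≢q' (MaybeP.just-injective
            (trans (sym rival-b) (trans (subst (λ x → rival x ≡ N x) a≡b eq) N-b))))
          cases (no _) (yes a≡cur) =
            subst (λ x → rival′ x ≡ N x) (sym a≡cur) (trans (↦-same rival⁻ cur (just post)) (sym N-cur))
          cases (no a≢b) (no a≢cur) =
            trans (↦-other rival⁻ cur (just post) a a≢cur) (trans (↦-other rival b nothing a a≢b) eq)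

        agreement-grows : agreement rival < agreement rival′
        agreement-grows = count-strict nA still-agrees cur
          (dec-false (rival cur ≟M N cur) (λ eq → nothing≢just (trans (sym rival-cur-free) (trans eq N-cur))))
          (dec-true (rival′ cur ≟M N cur) (trans (↦-same rival⁻ cur (just post)) (sym N-cur)))
          where
          nothing≢just : ∀ {r} → nothing ≢ just r
          nothing≢just ()
          still-agrees : ∀ a → does (rival a ≟M N a) ≡ true → does (rival′ a ≟M N a) ≡ true
          still-agrees a h = dec-true (rival′ a ≟M N a) (rival′-agrees a (agrees⇒≡ h))

    step-along : (st : State) → ∀ b → State.rival st b ≡ just (State.post st) → Progress st
    step-along st b rival-b with State.cand st b in cand-b
    ... | nothing = inj₁ (Step.finish st b rival-b cand-b)
    ... | just q' = inj₂ (Advance.next , Advance.agreement-grows)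
      where module Advance = Step.Advance st b rival-b q' cand-b

    -- One step: if no applicant holds `post` in the rival, giving it to cur
    -- would make the rival larger than the maximum matching N.
    step : (st : State) → Progress st
    step st with FinP.any? (λ b → State.rival st b ≟M just (State.post st))
    ... | yes (b , rival-b) = step-along st b rival-b
    ... | no  ¬holder       = ⊥-elim (<⇒≱ larger (maximum-bound N-max rival⁺ rival⁺-matching))
      where
      open State st
      rival⁺ = rival [ cur ↦ just post ]
      rival⁺-matching : IsMatching K rival⁺
      rival⁺-matching = match-matching cur post rival-matching (proj₁ (proj₁ N-max) cur post N-cur)
                          (λ x _ h → ¬holder (x , h))
      larger : msize N < msize rival⁺
      larger = ≤-trans (s≤s rival-size) (≤-reflexive (msize-match rival cur rival-cur-free))

    -- Agreement is bounded by nA, so nA + 1 steps suffice.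
    iterate : ∀ fuel (st : State) → nA < agreement (State.rival st) + fuel → Exchanged
    iterate zero st h = ⊥-elim (<⇒≱ (subst (nA <_) (+-identityʳ _) h) (count≤ nA _))
    iterate (suc fuel) st h with step st
    ... | inj₁ done         = done
    ... | inj₂ (st' , grew) =
      iterate fuel st' (≤-trans h (≤-trans (≤-reflexive (+-suc _ fuel)) (+-monoˡ-≤ fuel grew)))

    exchange : ∀ Y → IsMatching K Y → msize N ≤ msize Y → Y a₁ ≡ nothing → Exchanged
    exchange Y Y-matching N≤Y Y-a₁ = iterate (suc nA) initial (m≤n+m (suc nA) (agreement Y))
      where
      N⁻ = N [ a₁ ↦ nothing ]
      N⁻-posts : PostsOfN N⁻
      N⁻-posts a r h with a Fin.≟ a₁
      N⁻-posts a r () | yes _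
      ... | no _ = a , h
      post-free : ∀ a → N⁻ a ≢ just q₀
      post-free a h with a Fin.≟ a₁
      post-free a () | yes _
      ... | no a≢a₁ = a≢a₁ (proj₂ (proj₁ N-max) a a₁ q₀ h N-a₁)
      differs : ∀ a → N⁻ a ≢ N a → Y a ≡ N a ⊎ a ≡ a₁
      differs a h with a Fin.≟ a₁
      ... | yes a≡a₁ = inj₂ a≡a₁
      ... | no _     = ⊥-elim (h refl)
      initial : State
      initial = record
        { cand = N⁻ ; rival = Y ; cur = a₁ ; post = q₀
        ; cand-matching  = unmatch-matching a₁ (proj₁ N-max)
        ; rival-matching = Y-matching
        ; cand-size      = ≤-reflexive (msize-unmatch N a₁ N-a₁)
        ; rival-size     = N≤Y
        ; rival-cur-free = Y-a₁
        ; post-free      = post-free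
        ; N-cur          = N-a₁
        ; cand-a₁-free   = ↦-same N a₁ nothing
        ; cand-posts     = N⁻-posts
        ; cand-differs   = differs }

  exchange-free-applicant : ∀ {K : BGraph nA nP} {N Y} a₁ → IsMaximumMatching K N →
    IsMaximumMatching K Y → Y a₁ ≡ nothing →
    Σ (Assignment nA nP) λ N' → IsMaximumMatching K N' × N' a₁ ≡ nothing ×
      (∀ a r → N' a ≡ just r → ∃ λ b → N b ≡ just r)
  exchange-free-applicant {N = N} {Y} a₁ N-max Y-max Y-a₁ with N a₁ in N-a₁
  ... | nothing = N , N-max , N-a₁ , λ a _ h → a , h
  ... | just q₀ with Exchange.exchange N N-max a₁ q₀ N-a₁ Y (proj₁ Y-max) (maximum-bound Y-max N (proj₁ N-max)) Y-a₁
  ...   | N' , N'-matching , N≤N' , N'-a₁ , posts = N' , maximum-≥ N-max N'-matching N≤N' , N'-a₁ , posts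

-- The rank-one edges of a rank-maximal matching M form a
-- maximum matching of G₁: the first signature entry counts them, and the
-- entry at rank 0 vanishes for every matching of G.

≡ᵇ-true : ∀ m n → m ≡ n → (m ≡ᵇ n) ≡ true
≡ᵇ-true m n eq = Equivalence.to T-≡ (≡⇒≡ᵇ m n eq)

≡ᵇ-false : ∀ m n → m ≢ n → (m ≡ᵇ n) ≡ false
≡ᵇ-false zero    zero    m≢n = ⊥-elim (m≢n refl)
≡ᵇ-false zero    (suc n) _   = refl
≡ᵇ-false (suc m) zero    _   = refl
≡ᵇ-false (suc m) (suc n) m≢n = ≡ᵇ-false m n (m≢n ∘ cong suc)

module _ {nA nP : ℕ} (rank : Rank nA nP) where

  hasRank : ℕ → Fin nA → Maybe (Fin nP) → Bool
  hasRank i a (just p) = rank a p ≡ᵇ i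
  hasRank i a nothing  = false

  module _ (m : Assignment nA nP) (i : ℕ) where
    signature-pointwise : ∀ a → _ ≡ hasRank i a (m a)

    signature≡count : signature rank m i ≡ count nA (λ a → hasRank i a (m a))
    signature≡count = countB-as-count signature-pointwise

    signature-pointwise a with m a
    ... | just _  = refl
    ... | nothing = refl

  signature-rank0 : ∀ m → IsMatching (graphOf rank) m → signature rank m 0 ≡ 0
  signature-rank0 m (edges , _) = trans (signature≡count m 0) (count-none nA _ no-rank0)
    where
    no-rank0 : ∀ a → hasRank 0 a (m a) ≡ false
    no-rank0 a with m a in ma
    ... | just p  = ≡ᵇ-false (rank a p) 0 (edges a p ma)
    ... | nothing = refl

  signature-G₁ : ∀ m → IsMatching (G₁ rank) m → signature rank m 1 ≡ msize m
  signature-G₁ m (edges , _) = trans (signature≡count m 1) (count-cong nA rank-one)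
    where
    rank-one : ∀ a → hasRank 1 a (m a) ≡ is-just (m a)
    rank-one a with m a in ma
    ... | just p  = ≡ᵇ-true (rank a p) 1 (edges a p ma)
    ... | nothing = refl

  G₁⊆G : ∀ {m} → IsMatching (G₁ rank) m → IsMatching (graphOf rank) m
  G₁⊆G (edges , injective) = (λ a p h rank≡0 → 1≢0 (trans (sym (edges a p h)) rank≡0)) , injective
    where
    1≢0 : 1 ≢ 0
    1≢0 ()

  keepRankOne : Fin nA → Maybe (Fin nP) → Maybe (Fin nP)
  keepRankOne a (just p) = if rank a p ≡ᵇ 1 then just p else nothing
  keepRankOne a nothing  = nothing

  keepRankOne-sound : ∀ a x q → keepRankOne a x ≡ just q → x ≡ just q × rank a q ≡ 1
  keepRankOne-sound a (just p) q h with rank a p ≡ᵇ 1 in rank≡ᵇ1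
  keepRankOne-sound a (just p) q refl | true = refl , ≡ᵇ⇒≡ (rank a p) 1 (Equivalence.from T-≡ rank≡ᵇ1)

  keepRankOne-counts : ∀ a x → is-just (keepRankOne a x) ≡ hasRank 1 a x
  keepRankOne-counts a (just p) with rank a p ≡ᵇ 1
  ... | true  = refl
  ... | false = refl
  keepRankOne-counts a nothing = refl

  rankOnePart : Assignment nA nP → Assignment nA nP
  rankOnePart M a = keepRankOne a (M a)

  rankOnePart-matching : ∀ {M} → IsMatching (graphOf rank) M → IsMatching (G₁ rank) (rankOnePart M)
  rankOnePart-matching {M} (_ , injective) =
    (λ a q h → proj₂ (keepRankOne-sound a (M a) q h)) ,
    (λ a a' q h h' → injective a a' q (proj₁ (keepRankOne-sound a (M a) q h))
                                       (proj₁ (keepRankOne-sound a' (M a') q h')))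

  signature-rankOnePart : ∀ M → signature rank M 1 ≡ msize (rankOnePart M)
  signature-rankOnePart M = trans (signature≡count M 1) (count-cong nA (λ a → sym (keepRankOne-counts a (M a))))

  -- A larger G₁-matching Z would agree with M at rank 0 and beat it at rank 1.
  rankOnePart-maximum : ∀ {M} → IsRankMaximal rank M → IsMaximumMatching (G₁ rank) (rankOnePart M)
  rankOnePart-maximum {M} (M-matching , M-maximal) = maximum-intro (rankOnePart-matching M-matching) bound
    where
    bound : ∀ Z → IsMatching (G₁ rank) Z → msize Z ≤ msize (rankOnePart M)
    bound Z Z-matching with msize Z ≤? msize (rankOnePart M)
    ... | yes le = le
    ... | no  nle = ⊥-elim (M-maximal Z (G₁⊆G Z-matching) (1 , same-rank0 , beats))
      where
      same-rank0 : ∀ j → j < 1 → signature rank Z j ≡ signature rank M j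
      same-rank0 zero _ = trans (signature-rank0 Z (G₁⊆G Z-matching)) (sym (signature-rank0 M M-matching))
      same-rank0 (suc j) (s≤s ())
      beats : signature rank M 1 < signature rank Z 1
      beats = subst₂ _<_ (sym (signature-rankOnePart M)) (sym (signature-G₁ Z Z-matching)) (≰⇒> nle)

  rankOnePart-free : ∀ {M a₁} → ¬ (∃ λ p → (M a₁ ≡ just p) × (rank a₁ p ≡ 1)) → rankOnePart M a₁ ≡ nothing
  rankOnePart-free {M} {a₁} not-rank-one with rankOnePart M a₁ in eq
  ... | nothing = refl
  ... | just q  = ⊥-elim (not-rank-one (q , keepRankOne-sound a₁ (M a₁) q eq))

  deleted⇒G₁ : ∀ {a₁ m} → IsMatching (G₁-minus rank a₁) m → IsMatching (G₁ rank) m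
  deleted⇒G₁ (edges , injective) = (λ a q h → proj₁ (edges a q h)) , injective

  G₁⇒deleted : ∀ {a₁ m} → IsMatching (G₁ rank) m → m a₁ ≡ nothing → IsMatching (G₁-minus rank a₁) m
  G₁⇒deleted {a₁} {m} (edges , injective) m-a₁ =
    (λ a q h → edges a q h , λ { refl → nothing≢just (trans (sym m-a₁) h) }) , injective
    where
    nothing≢just : ∀ {q} → nothing ≢ just q
    nothing≢just ()

  -- When a maximum matching Y of G₁ leaves a₁ free, G₁ and G₁ - a₁ have the
  -- same maximum size, so the maximum matchings of G₁ - a₁ are exactly the
  -- maximum matchings of G₁ leaving a₁ free.
  module _ {a₁ : Fin nA} {Y : Assignment nA nP} (Y-max : IsMaximumMatching (G₁ rank) Y) (Y-a₁ : Y a₁ ≡ nothing) where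

    maximum-deleted⇒G₁ : ∀ {m} → IsMaximumMatching (G₁-minus rank a₁) m → IsMaximumMatching (G₁ rank) m
    maximum-deleted⇒G₁ m-max = maximum-≥ Y-max (deleted⇒G₁ (proj₁ m-max))
                                 (maximum-bound m-max Y (G₁⇒deleted (proj₁ Y-max) Y-a₁))

    maximum-G₁⇒deleted : ∀ {m} → IsMaximumMatching (G₁ rank) m → m a₁ ≡ nothing →
                         IsMaximumMatching (G₁-minus rank a₁) m
    maximum-G₁⇒deleted m-max m-a₁ =
      maximum-intro (G₁⇒deleted (proj₁ m-max) m-a₁) (λ z z-matching → maximum-bound m-max z (deleted⇒G₁ z-matching))

    -- Hence a post is covered by every maximum matching of G₁ - a₁ iff it is
    -- covered by every maximum matching of G₁: a maximum matching of G₁ leaving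
    -- p free is exchanged into one leaving a₁ free as well.
    covered-deleted⇔G₁ : ∀ p → CoveredByAllMaximum (G₁-minus rank a₁) p ⇔ CoveredByAllMaximum (G₁ rank) p
    covered-deleted⇔G₁ p = mk⇔ to from
      where
      to : CoveredByAllMaximum (G₁-minus rank a₁) p → CoveredByAllMaximum (G₁ rank) p
      to covered m m-max p-free with exchange-free-applicant a₁ m-max Y-max Y-a₁
      ... | m' , m'-max , m'-a₁ , posts-of-m =
        covered m' (maximum-G₁⇒deleted m'-max m'-a₁) λ a m'-a → let (b , m-b) = posts-of-m a p m'-a in p-free b m-b
      from : CoveredByAllMaximum (G₁ rank) p → CoveredByAllMaximum (G₁-minus rank a₁) p
      from covered m m-max = covered m (maximum-deleted⇒G₁ m-max)

  G₁? : ∀ a p → Dec (G₁ rank a p)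
  G₁? a p = rank a p ≟ 1

  G₁-minus? : ∀ a₁ a p → Dec (G₁-minus rank a₁ a p)
  G₁-minus? a₁ a p = (rank a p ≟ 1) ×-dec ¬? (a Fin.≟ a₁)

lemma4 : ∀ {nA nP} (rank : Rank nA nP) (a₁ : Fin nA) →
         (∃ λ M → IsRankMaximal rank M ×
            ¬ (∃ λ p → (M a₁ ≡ just p) × (rank a₁ p ≡ 1))) →
         ∀ (p : Fin nP) → IsFPost rank a₁ p ⇔ InOU (G₁ rank) (inj₂ p)
lemma4 rank a₁ (M , M-rank-maximal , not-rank-one) p =
  mk⇔ (covered⇒InOU (G₁? rank) ∘ to ∘ InOU⇒covered)
      (covered⇒InOU (G₁-minus? rank a₁) ∘ from ∘ InOU⇒covered)
  where
  open Equivalence (covered-deleted⇔G₁ rank (rankOnePart-maximum rank M-rank-maximal)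
                                             (rankOnePart-free rank {M} not-rank-one) p)
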